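{- Let $M$ be a locally bounded commutative ordered monoid with distinguished element $0$, with $0\leq1$, whose multiplication is continuous, preadmissible, and satisfies condition (*) relative to $\overline{M}$. Equip the completion $\overline{M}$ with the multiplication $xy=\sup P_{x,y}$. Then this multiplication on $\overline{M}$ extends the multiplication on $M$: for all $m,m'\in M$, the product of $m$ and $m'$ in $\overline{M}$ equals their product in $M$.
   Context: All reasoning is constructive (no law of excluded middle). An ordered set is a set $X$ with a binary relation $<$ satisfying, for all $x,y,z$: asymmetry ($x<y$ implies not $y<x$), cotransitivity ($x<y$ implies $x<z$ or $z<y$), and negative antisymmetry (not $x<y$ and not $y<x$ imply $x=y$). Write $x\leq y$ for "not $y<x$", $x>y$ for $y<x$. A subset $S$ of $X$ is almost dense if $x<y$ in $X$ implies $x\leq s<s'\leq y$ for some $s,s'\in S$; bicofinal if each $x\in X$ satisfies $s\leq x\leq s'$ for some $s,s'\in S$; upper order located if $x<y$ implies either $x<s$ for some $s\in S$ or $u<y$ for some upper bound $u$ of $S$; supable if nonempty, bounded above and upper order located. $X$ is complete if every supable subset has a supremum in $X$. A completion of $X$ is a complete ordered set $Y$ with an order embedding ($x<x'$ iff $f(x)<f(x')$) $f:X\to Y$ whose image is almost dense and bicofinal in $Y$; it exists and is unique up to isomorphism, and $\overline{M}$ denotes the completion of $M$, with $M$ identified with its image. A set is finitely enumerable if it is empty or the image of $\{1,\dots,n\}$. A commutative ordered monoid with distinguished element $0$ is an ordered set $M$ with a distinguished element $0$ and a commutative monoid multiplication (identity $1$) such that $0<x,0<y$ imply $0<xy$;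 it is locally bounded if every finitely enumerable subset has a minimum and a maximum. The multiplication on $M$ is preadmissible if $0x=0=x0$, $x<y$ and $z>0$ imply $xz<yz$, and $x<y$ and $z<0$ imply $xz>yz$. Continuity refers to the order topology on $M$ (generated by open intervals $\{z:a<z<b\}$) and the product topology on $M\times M$. Condition (*): for all $x,y\in\overline{M}$, if $c<d$ in $M$ then there are $a,b,a',b'\in M$ with $a\leq x\leq b$, $a'\leq y\leq b'$ and either $c<\min\{aa',ab',ba',bb'\}$ or $\max\{aa',ab',ba',bb'\}<d$ (min, max in $M$). For $x,y\in\overline{M}$, $P_{x,y}=\{\min\{aa',ab',ba',bb'\}: a,b,a',b'\in M,\ a\leq x\leq b,\ a'\leq y\leq b'\}$; under these hypotheses $P_{x,y}$ is supable, so $xy:=\sup P_{x,y}$ exists in $\overline{M}$. -}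

module Defs where

open import Data.Nat using (ℕ; suc)
open import Data.Fin using (Fin)
open import Data.Product using (Σ; ∃; ∃-syntax; _×_; _,_)
open import Data.Sum using (_⊎_)
open import Data.List using (List)
open import Data.List.Relation.Unary.All using (All)
open import Relation.Nullary using (¬_)
open import Relation.Binary.PropositionalEquality using (_≡_)
open import Algebra.Structures using (IsCommutativeMonoid)

record OrderedSet : Set₁ where
  field
    Carrier    : Set
    _<_        : Carrier → Carrier → Set
    asym       : ∀ {x y} → x < y → ¬ (y < x)
    cotrans    : ∀ {x y} (z : Carrier) → x < y → (x < z) ⊎ (z < y)
    negAntisym : ∀ {x y} → ¬ (x < y) → ¬ (y < x) → x ≡ y

  _≤_ : Carrier → Carrier → Set
  x ≤ y = ¬ (y < x)

module OS (X : OrderedSet) where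
  open OrderedSet X

  Subset : Set₁
  Subset = Carrier → Set

  AlmostDense : Subset → Set
  AlmostDense S = ∀ x y → x < y →
    ∃[ s ] ∃[ s' ] (S s × S s' × x ≤ s × s < s' × s' ≤ y)

  Bicofinal : Subset → Set
  Bicofinal S = ∀ x → ∃[ s ] ∃[ s' ] (S s × S s' × s ≤ x × x ≤ s')

  UpperBound : Subset → Carrier → Set
  UpperBound S u = ∀ s → S s → s ≤ u

  UpperOrderLocated : Subset → Set
  UpperOrderLocated S = ∀ x y → x < y →
    (∃[ s ] (S s × x < s)) ⊎ (∃[ u ] (UpperBound S u × u < y))

  Supable : Subset → Set
  Supable S = (∃[ s ] S s) × (∃[ u ] UpperBound S u) × UpperOrderLocated S

  IsSup : Subset → Carrier → Set
  IsSup S s = UpperBound S s × (∀ x → x < s → ∃[ t ] (S t × x < t))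

  Complete : Set₁
  Complete = ∀ (S : Subset) → Supable S → ∃[ s ] IsSup S s

  -- minimum / maximum of a finitely enumerable inhabited set, given as
  -- the image of g : Fin (suc n) → Carrier
  HasMinimum : ∀ {n} → (Fin (suc n) → Carrier) → Set
  HasMinimum g = ∃[ i ] (∀ j → g i ≤ g j)

  HasMaximum : ∀ {n} → (Fin (suc n) → Carrier) → Set
  HasMaximum g = ∃[ i ] (∀ j → g j ≤ g i)

  IsMin4 : Carrier → Carrier → Carrier → Carrier → Carrier → Set
  IsMin4 m w x y z =
    (m ≡ w ⊎ m ≡ x ⊎ m ≡ y ⊎ m ≡ z) × m ≤ w × m ≤ x × m ≤ y × m ≤ z

  IsMax4 : Carrier → Carrier → Carrier → Carrier → Carrier → Set
  IsMax4 m w x y z =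
    (m ≡ w ⊎ m ≡ x ⊎ m ≡ y ⊎ m ≡ z) × w ≤ m × x ≤ m × y ≤ m × z ≤ m

  InIntervals : List (Carrier × Carrier) → Carrier → Set
  InIntervals I u = All (λ { (a , b) → a < u × u < b }) I

record Completion (X : OrderedSet) : Set₁ where
  open OrderedSet X
  field
    Y : OrderedSet
  open OrderedSet Y renaming (Carrier to Ȳ; _<_ to _<'_)
  field
    f         : Carrier → Ȳ
    embedding : ∀ x x' → (x < x' → f x <' f x') × (f x <' f x' → x < x')
  Image : Ȳ → Set
  Image y = ∃[ x ] (f x ≡ y)
  field
    almostDense : OS.AlmostDense Y Image
    bicofinal   : OS.Bicofinal Y Image
    complete    : OS.Complete Y

record OrdMonoid : Set₁ where
  field
    ord : OrderedSet
  open OrderedSet ord public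
  field
    0#    : Carrier
    1#    : Carrier
    _*_   : Carrier → Carrier → Carrier
    isCommutativeMonoid : IsCommutativeMonoid _≡_ _*_ 1#
    pos   : ∀ {x y} → 0# < x → 0# < y → 0# < (x * y)

module _ (M : OrdMonoid) where
  open OrdMonoid M
  open OS ord

  LocallyBounded : Set
  LocallyBounded = ∀ n (g : Fin (suc n) → Carrier) → HasMinimum g × HasMaximum g

  Preadmissible : Set
  Preadmissible =
    (∀ x → (0# * x ≡ 0#) × (x * 0# ≡ 0#)) ×
    (∀ x y z → x < y → 0# < z → (x * z) < (y * z)) ×
    (∀ x y z → x < y → z < 0# → (y * z) < (x * z))

  -- continuity of _*_ : M × M → M for the order topology (subbasis: open
  -- intervals) and the product topology: the preimage of every open interval
  -- is open, i.e. each point of it has a neighbourhood U × V, U and V finite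
  -- intersections of open intervals, contained in the preimage.
  ContinuousMul : Set
  ContinuousMul = ∀ a b x y → a < (x * y) → (x * y) < b →
    ∃[ I ] ∃[ J ] (InIntervals I x × InIntervals J y ×
      (∀ u v → InIntervals I u → InIntervals J v → a < (u * v) × (u * v) < b))

  module _ (C : Completion ord) where
    open Completion C
    open OrderedSet Y using () renaming (Carrier to Ȳ; _≤_ to _≤'_)

    ConditionStar : Set
    ConditionStar = ∀ (x y : Ȳ) (c d : Carrier) → c < d →
      ∃[ a ] ∃[ b ] ∃[ a' ] ∃[ b' ]
        (f a ≤' x × x ≤' f b × f a' ≤' y × y ≤' f b' ×
         ((∃[ m ] (IsMin4 m (a * a') (a * b') (b * a') (b * b') × c < m)) ⊎
          (∃[ m ] (IsMax4 m (a * a') (a * b') (b * a') (b * b') × m < d))))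

    -- the set P_{x,y} ⊆ M̄ (M identified with its image under f)
    P : Ȳ → Ȳ → OS.Subset Y
    P x y p = ∃[ a ] ∃[ b ] ∃[ a' ] ∃[ b' ] ∃[ m ]
      (f a ≤' x × x ≤' f b × f a' ≤' y × y ≤' f b' ×
       IsMin4 m (a * a') (a * b') (b * a') (b * b') × f m ≡ p)

-- The product m m' is itself an element of P_{m,m'} (take a = b = m and a' = b' = m'),
-- and it bounds every element of P_{m,m'} from above: for a ≤ m ≤ b and a' ≤ m' ≤ b',
-- preadmissibility makes the product quasi-concave in each factor separately (whatever the
-- sign of the other factor, anything below the products at both endpoints of an interval
-- is below the product at an inner point), so nothing can lie strictly below all four
-- corner products and above m m' at once. Hence m m' is the greatest element of P_{m,m'}.
module Submission where

open import Defs
open import Relation.Binary.PropositionalEquality using (_≡_; refl; subst; subst₂)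
open import Data.Product using (_×_; _,_; proj₁; proj₂)
open import Data.Sum using (inj₁; inj₂)
open import Data.Empty using (⊥; ⊥-elim)
open import Relation.Nullary using (¬_)
open import Algebra.Structures using (IsCommutativeMonoid)

module OrderedSetProperties (X : OrderedSet) where
  open OrderedSet X
  open OS X

  <-irrefl : ∀ {x} → ¬ (x < x)
  <-irrefl x<x = asym x<x x<x

  ≤-antisym : ∀ {x y} → x ≤ y → y ≤ x → x ≡ y
  ≤-antisym x≤y y≤x = negAntisym y≤x x≤y

  <-≤-trans : ∀ {x y z} → x < y → y ≤ z → x < z
  <-≤-trans {z = z} x<y y≤z with cotrans z x<y
  ... | inj₁ x<z = x<z
  ... | inj₂ z<y = ⊥-elim (y≤z z<y)

  <-both-not-both-<⇒< : ∀ {p u v w} → p < u → p < v → ¬ (w < u × w < v) → p < w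
  <-both-not-both-<⇒< {w = w} p<u p<v w≮both with cotrans w p<u | cotrans w p<v
  ... | inj₁ p<w | _        = p<w
  ... | inj₂ _   | inj₁ p<w = p<w
  ... | inj₂ w<u | inj₂ w<v = ⊥-elim (w≮both (w<u , w<v))

  IsSup⇒upper : ∀ {S s x} → IsSup S s → S x → x ≤ s
  IsSup⇒upper (upper , _) = upper _

  IsSup⇒least : ∀ {S s u} → IsSup S s → UpperBound S u → s ≤ u
  IsSup⇒least (_ , approx) u-upper u<s with approx _ u<s
  ... | t , t∈S , u<t = u-upper t t∈S u<t

module PreadmissibleProperties (M : OrdMonoid) (pre : Preadmissible M) where
  open OrdMonoid M
  open OS ord
  open OrderedSetProperties ord

  private
    *-comm : ∀ x y → (x * y) ≡ (y * x)
    *-comm = IsCommutativeMonoid.comm isCommutativeMonoid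

    zeroʳ : ∀ x → x * 0# ≡ 0#
    zeroʳ x = proj₂ (proj₁ pre x)

    *-monoˡ-<-pos : ∀ {x y z} → x < y → 0# < z → (x * z) < (y * z)
    *-monoˡ-<-pos = proj₁ (proj₂ pre) _ _ _

    *-antimonoˡ-<-neg : ∀ {x y z} → x < y → z < 0# → (y * z) < (x * z)
    *-antimonoˡ-<-neg = proj₂ (proj₂ pre) _ _ _

  *-monoˡ-≤-pos : ∀ {x y z} → x ≤ y → 0# < z → (x * z) ≤ (y * z)
  *-monoˡ-≤-pos {x} {y} {z} x≤y 0<z yz<xz = <-irrefl (subst (λ w → (y * z) < (w * z)) x≡y yz<xz)
    where
    x≡y : x ≡ y
    x≡y = negAntisym (λ x<y → asym (*-monoˡ-<-pos x<y 0<z) yz<xz) x≤y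

  *-antimonoˡ-≤-neg : ∀ {x y z} → x ≤ y → z < 0# → (y * z) ≤ (x * z)
  *-antimonoˡ-≤-neg {x} {y} {z} x≤y z<0 xz<yz = <-irrefl (subst (λ w → (w * z) < (y * z)) x≡y xz<yz)
    where
    x≡y : x ≡ y
    x≡y = negAntisym (λ x<y → asym (*-antimonoˡ-<-neg x<y z<0) xz<yz) x≤y

  -- The sign of z cannot be decided, but the goal is negative, so it suffices to refute
  -- 0 < z and z < 0 and then treat z ≡ 0.
  *-not-below-both-endpoints : ∀ {lo mid hi z} → lo ≤ mid → mid ≤ hi →
    ¬ ((mid * z) < (lo * z) × (mid * z) < (hi * z))
  *-not-below-both-endpoints {lo} {mid} {hi} {z} lo≤mid mid≤hi (below-lo , below-hi) =
    z≡0-case (λ z<0 → *-antimonoˡ-≤-neg mid≤hi z<0 below-hi)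
             (λ 0<z → *-monoˡ-≤-pos lo≤mid 0<z below-lo)
    where
    z≡0-case : ¬ z < 0# → ¬ 0# < z → ⊥
    z≡0-case z≮0 0≮z with negAntisym z≮0 0≮z
    ... | refl = <-irrefl (subst₂ _<_ (zeroʳ mid) (zeroʳ lo) below-lo)

  *-<-interpolateˡ : ∀ {p lo mid hi z} → lo ≤ mid → mid ≤ hi →
    p < (lo * z) → p < (hi * z) → p < (mid * z)
  *-<-interpolateˡ lo≤mid mid≤hi p<lo p<hi =
    <-both-not-both-<⇒< p<lo p<hi (*-not-below-both-endpoints lo≤mid mid≤hi)

  *-<-interpolateʳ : ∀ {p lo mid hi z} → lo ≤ mid → mid ≤ hi →
    p < (z * lo) → p < (z * hi) → p < (z * mid)
  *-<-interpolateʳ {p} {lo} {mid} {hi} {z} lo≤mid mid≤hi p<lo p<hi =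
    subst (p <_) (*-comm mid z)
      (*-<-interpolateˡ lo≤mid mid≤hi
        (subst (p <_) (*-comm z lo) p<lo) (subst (p <_) (*-comm z hi) p<hi))

  *-<-interpolate : ∀ {p a m b a' m' b'} → a ≤ m → m ≤ b → a' ≤ m' → m' ≤ b' →
    p < (a * a') → p < (a * b') → p < (b * a') → p < (b * b') → p < (m * m')
  *-<-interpolate a≤m m≤b a'≤m' m'≤b' p<aa' p<ab' p<ba' p<bb' =
    *-<-interpolateˡ a≤m m≤b
      (*-<-interpolateʳ a'≤m' m'≤b' p<aa' p<ab')
      (*-<-interpolateʳ a'≤m' m'≤b' p<ba' p<bb')

  min4-corners-≤ : ∀ {q a m b a' m' b'} → a ≤ m → m ≤ b → a' ≤ m' → m' ≤ b' →
    IsMin4 q (a * a') (a * b') (b * a') (b * b') → q ≤ (m * m')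
  min4-corners-≤ a≤m m≤b a'≤m' m'≤b' (_ , q≤aa' , q≤ab' , q≤ba' , q≤bb') mm'<q =
    <-irrefl (*-<-interpolate a≤m m≤b a'≤m' m'≤b'
      (<-≤-trans mm'<q q≤aa') (<-≤-trans mm'<q q≤ab')
      (<-≤-trans mm'<q q≤ba') (<-≤-trans mm'<q q≤bb'))

module ProductSetProperties (M : OrdMonoid) (pre : Preadmissible M) (C : Completion (OrdMonoid.ord M)) where
  open OrdMonoid M
  open Completion C
  open OrderedSet Y using () renaming (_<_ to _<'_; _≤_ to _≤'_)
  open OS Y using (UpperBound)
  open OrderedSetProperties ord using (<-irrefl)
  open OrderedSetProperties Y using () renaming (<-irrefl to <'-irrefl)
  open PreadmissibleProperties M pre using (min4-corners-≤)

  f-reflects-< : ∀ {u v} → f u <' f v → u < v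
  f-reflects-< = proj₂ (embedding _ _)

  f-reflects-≤ : ∀ {u v} → f u ≤' f v → u ≤ v
  f-reflects-≤ fu≤fv v<u = fu≤fv (proj₁ (embedding _ _) v<u)

  product∈P : ∀ m m' → P M C (f m) (f m') (f (m * m'))
  product∈P m m' = m , m , m' , m' , m * m' , <'-irrefl , <'-irrefl , <'-irrefl , <'-irrefl ,
    (inj₁ refl , <-irrefl , <-irrefl , <-irrefl , <-irrefl) , refl

  product-upperBound-P : ∀ m m' → UpperBound (P M C (f m) (f m')) (f (m * m'))
  product-upperBound-P m m' _ (a , b , a' , b' , q , fa≤ , ≤fb , fa'≤ , ≤fb' , q-min , refl) fmm'<fq =
    min4-corners-≤ (f-reflects-≤ fa≤) (f-reflects-≤ ≤fb) (f-reflects-≤ fa'≤) (f-reflects-≤ ≤fb')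
      q-min (f-reflects-< fmm'<fq)

theorem16 : (M : OrdMonoid) → LocallyBounded M →
    OrderedSet._≤_ (OrdMonoid.ord M) (OrdMonoid.0# M) (OrdMonoid.1# M) →
    ContinuousMul M → Preadmissible M →
    (C : Completion (OrdMonoid.ord M)) → ConditionStar M C →
    ∀ m m' s → OS.IsSup (Completion.Y C) (P M C (Completion.f C m) (Completion.f C m')) s →
    s ≡ Completion.f C (OrdMonoid._*_ M m m')
theorem16 M _ _ _ pre C _ m m' s s-sup =
  ≤-antisym (IsSup⇒least s-sup (product-upperBound-P m m'))
            (IsSup⇒upper s-sup (product∈P m m'))
  where
  open OrderedSetProperties (Completion.Y C)
  open ProductSetProperties M pre C
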